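{- In algorithm Build-Sketches (described in the context), for every iteration index $i$ that is executed, after the $i$-th iteration $X_v=\widetilde{N_i(v)}$ for all $v\in V$.
   Context: $G=(V,E)$ is an undirected unweighted graph; $N_d(v)$ is the set of vertices at distance at most $d$ from $v$, $N(v)=N_1(v)$, and $N(A)=\bigcup_{u\in A}N(u)$. Each vertex $v$ has an independent random rank $r_v\sim U(0,1)$ (assumed distinct). For $S\subseteq V$ and an integer $k\ge1$, $\widetilde S$ is the set of the $k$ elements of $S$ with smallest ranks ($\widetilde S=S$ if $|S|<k$). Merge-and-Purify$(X,\{v\})$ returns the $k$ smallest-rank elements of $X\cup\{v\}$. Build-Sketches$(G,\ell)$: initialize $X_v=\{v\}$ for all $v\in V$. Repeat at most $\ell$ times: for every $v\in V$ in increasing order of $r_v$, let $A_v$ be the set of vertices $u$ such that $v$ was added to $X_u$ in the previous iteration (for the first iteration, $A_v=\{v\}$ from the initialization), and for every $w\in N(A_v)$ set $X_w\leftarrow$ Merge-and-Purify$(X_w,\{v\})$; if no $X_v$ was modified during the iteration, stop. Return $\{X_v\}_{v\in V}$. -}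

module Defs where

open import Data.Nat using (ℕ; zero; suc; _≤_; _<_; _≤ᵇ_)
open import Data.Fin using (Fin; _≟_)
open import Data.List using (List; []; _∷_; foldr; foldl; take; filterᵇ; allFin; deduplicate; length)
open import Data.List.Properties using (≡-dec)
open import Data.List.Relation.Unary.All using (All)
open import Data.List.Relation.Unary.Unique.Propositional using (Unique)
open import Data.List.Membership.Propositional using (_∈_)
open import Data.Bool.ListAction using (any)
open import Data.Bool using (Bool; true; false; if_then_else_; not; _∧_; _∨_)
open import Data.Product using (_×_; _,_; Σ; proj₁; proj₂)


open import Relation.Nullary using (¬_; does)
open import Relation.Binary.PropositionalEquality using (_≡_)


record Graph (n : ℕ) : Set where
  field
    adj    : Fin n → Fin n → Bool
    sym    : ∀ u v → adj u v ≡ adj v u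
    irrefl : ∀ v → adj v v ≡ false
open Graph public

-- Dist≤ G d v u : there is a walk of length at most d from v to u,
-- i.e. dist(v,u) ≤ d, i.e. u ∈ N_d(v).
data Dist≤ {n : ℕ} (G : Graph n) : ℕ → Fin n → Fin n → Set where
  here : ∀ {d v} → Dist≤ G d v v
  step : ∀ {d v w u} → adj G v w ≡ true → Dist≤ G d w u → Dist≤ G (suc d) v u

Ball : ∀ {n} → Graph n → ℕ → Fin n → Fin n → Set
Ball G d v u = Dist≤ G d v u

-- u ∈ S̃ (the k smallest-rank elements of S, or S itself if |S| < k):
-- u ∈ S and fewer than k (distinct) elements of S have rank smaller than u.
InTilde : ∀ {n} → (Fin n → ℕ) → ℕ → (Fin n → Set) → Fin n → Set
InTilde {n} rank k S u =
  S u × ¬ (Σ (List (Fin n)) λ ws →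
             length ws ≡ k × Unique ws × All (λ w → S w × rank w < rank u) ws)

module Algorithm {n : ℕ} (G : Graph n) (rank : Fin n → ℕ) (k : ℕ) where

  V : Set
  V = Fin n

  eqᵇ : V → V → Bool
  eqᵇ x y = does (x ≟ y)

  memb : V → List V → Bool
  memb v xs = any (eqᵇ v) xs

  insertR : V → List V → List V
  insertR v [] = v ∷ []
  insertR v (x ∷ xs) = if rank v ≤ᵇ rank x then v ∷ x ∷ xs else x ∷ insertR v xs

  sortR : List V → List V
  sortR = foldr insertR []

  mergePurify : List V → V → List V
  mergePurify X v = take k (sortR (deduplicate _≟_ (v ∷ X)))

  -- N(A) = ⋃_{u∈A} N_1(u)  (note N_1(u) contains u)
  nbhd : List V → List V
  nbhd A = filterᵇ (λ w → any (λ u → eqᵇ u w ∨ adj G u w) A) (allFin n)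

  Sketches : Set
  Sketches = V → List V

  upd : Sketches → V → List V → Sketches
  upd f w x u = if eqᵇ u w then x else f u

  -- (current sketches, "v was added to X_u" lists for this iteration, modified flag)
  IterState : Set
  IterState = Sketches × Sketches × Bool

  processW : V → IterState → V → IterState
  processW v (X , Anew , mod) w =
    let old   = X w
        new   = mergePurify old v
        added = not (memb v old) ∧ memb v new
    in upd X w new
     , (if added then upd Anew v (w ∷ Anew v) else Anew)
     , (mod ∨ not (does (≡-dec _≟_ new old)))

  processV : Sketches → IterState → V → IterState
  processV Aprev st v = foldl (processW v) st (nbhd (Aprev v))

  iteration : Sketches → Sketches → IterState
  iteration X Aprev = foldl (processV Aprev) (X , (λ _ → []) , false) (sortR (allFin n))

  -- (X, A) after i iterations (ignoring the stopping rule)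
  run : ℕ → Sketches × Sketches
  run zero = (λ v → v ∷ []) , (λ v → v ∷ [])
  run (suc i) =
    let st = iteration (proj₁ (run i)) (proj₂ (run i))
    in proj₁ st , proj₁ (proj₂ st)

  sketchesAfter : ℕ → Sketches
  sketchesAfter i = proj₁ (run i)

  modifiedIn : ℕ → Bool
  modifiedIn zero = true
  modifiedIn (suc j) = proj₂ (proj₂ (iteration (proj₁ (run j)) (proj₂ (run j))))

  Executed : ℕ → ℕ → Set
  Executed ℓ i = 1 ≤ i × i ≤ ℓ × (∀ j → 1 ≤ j → j < i → modifiedIn j ≡ true)

-- Induction on the number i of iterations, with the invariant that X_w consists of the k smallest-rank
-- vertices of N_i(w), every u ∈ A_v has dist(u, v) ≤ i, and every v ∈ X_u with dist(u, v) ≥ i has u ∈ A_v.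
-- An iteration processes the vertices in increasing rank, and Merge-and-Purify commutes with taking the
-- k smallest, so afterwards X_w consists of the k smallest of N_i(w) ∪ {v : w ∈ N(A_v)}. That set lies in
-- N_{i+1}(w) and contains the k smallest of N_{i+1}(w): a vertex z at distance i + 1 from w is among the
-- k smallest of N_i(y) for a neighbour y of w, and is new in X_y, so y ∈ A_z.
module Submission where

open import Defs
open import Data.Nat using (ℕ; _≤_)
open import Data.Fin using (Fin)
open import Data.List.Membership.Propositional using (_∈_)
open import Relation.Binary.PropositionalEquality using (_≡_)
open import Function.Definitions using (Injective)
open import Function.Bundles using (_⇔_)

open import Data.Bool using (true; false; T; T?; not; _∧_)
import Data.Bool.Properties as Bool
open import Data.Bool.Properties using (T-∨; T-≡)
open import Data.Empty using (⊥-elim)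
open import Data.Fin using (_≟_)
open import Data.Fin.Properties using (any?)
open import Data.List using (List; []; _∷_; _++_; [_]; _∷ʳ_; take; length; foldl; filter; deduplicate; allFin)
open import Data.List.Properties
  using (length-++-sucʳ; length-take; take-all; ++-identityʳ; ++-assoc; ∷ʳ-++; filter-++; filter-accept; filter-reject)
open import Data.List.Membership.Propositional using (_∉_; find)
open import Data.List.Membership.Propositional.Properties
  using (∈-∃++; ∈-++⁺ˡ; ∈-++⁺ʳ; ∈-++⁻; ∈-filter⁺; ∈-filter⁻; ∈-allFin; ∈-deduplicate⁻; ∈-deduplicate⁺)
import Data.List.Membership.DecPropositional as DecMembership
open import Data.List.Relation.Binary.Subset.Propositional using (_⊆_)
open import Data.List.Relation.Binary.Subset.Propositional.Properties using (filter⁺′; ++⁺ʳ)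
import Data.List.Relation.Binary.Sublist.Propositional as Sublist
import Data.List.Relation.Binary.Sublist.Propositional.Properties as Sublist
open import Data.List.Relation.Binary.Permutation.Propositional using (_↭_; ↭-refl; ↭-trans; ↭-sym; prep; swap)
open import Data.List.Relation.Binary.Permutation.Propositional.Properties using (∈-resp-↭; All-resp-↭; ∷↭∷ʳ)
open import Data.List.Relation.Unary.Any as Any using (here; there)
open import Data.List.Relation.Unary.Any.Properties using (any⁺; any⁻)
open import Data.List.Relation.Unary.All as All using (All; []; _∷_)
open import Data.List.Relation.Unary.AllPairs as AllPairs using (AllPairs; []; _∷_)
import Data.List.Relation.Unary.AllPairs.Properties as AllPairs
open import Data.List.Relation.Unary.Unique.Propositional using (Unique)
open import Data.List.Relation.Unary.Unique.Propositional.Properties using (allFin⁺; filter⁺)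
open import Data.List.Relation.Unary.Unique.DecPropositional.Properties using (deduplicate-!)
open import Data.Nat using (zero; suc; _<_; z≤n; s≤s; _<?_; _≤ᵇ_)
open import Data.Nat.Properties
  using (<-irrefl; <-asym; <-trans; ≤-trans; ≤-reflexive; ≤∧≢⇒<; ≰⇒>; m⊓n≤m; ≤ᵇ-reflects-≤)
open import Data.Product using (_×_; _,_; proj₁; proj₂)
open import Data.Sum using (_⊎_; inj₁; inj₂)
open import Data.Unit using (⊤; tt)
open import Function using (_∘_)
open import Function.Bundles using (Equivalence; mk⇔)
open import Function.Properties.Equivalence using () renaming (trans to ⇔-trans; sym to ⇔-sym)
open import Relation.Binary.Definitions using (DecidableEquality)
open import Relation.Binary.PropositionalEquality as ≡ using (_≢_; refl; cong; subst; trans; module ≡-Reasoning)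
open import Relation.Nullary using (¬_; Dec; yes; no)
open import Relation.Nullary.Decidable using (_×-dec_; dec-true; dec-false)
open import Relation.Nullary.Reflects using (ofʸ; ofⁿ)

module _ {a} {A : Set a} where

  ∈-take⁻ : ∀ m {xs : List A} → take m xs ⊆ xs
  ∈-take⁻ m = Sublist.lookup (Sublist.take-⊆ m _)

  ∈-++-∷-≢ : ∀ xs {ys} {x z : A} → z ∈ xs ++ x ∷ ys → z ≢ x → z ∈ xs ++ ys
  ∈-++-∷-≢ xs {ys} p z≢x with ∈-++⁻ xs p
  ... | inj₁ z∈xs = ∈-++⁺ˡ z∈xs
  ... | inj₂ (here z≡x) = ⊥-elim (z≢x z≡x)
  ... | inj₂ (there z∈ys) = ∈-++⁺ʳ xs z∈ys

  Unique∧⊆⇒length≤ : {xs ys : List A} → Unique xs → xs ⊆ ys → length xs ≤ length ys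
  Unique∧⊆⇒length≤ {[]} _ _ = z≤n
  Unique∧⊆⇒length≤ {x ∷ xs} (x∉xs ∷ xs!) x∷xs⊆ys with ∈-∃++ (x∷xs⊆ys (here refl))
  ... | ys₁ , ys₂ , refl = ≤-trans (s≤s (Unique∧⊆⇒length≤ xs! xs⊆ys₁++ys₂))
                                   (≤-reflexive (≡.sym (length-++-sucʳ ys₁ x ys₂)))
    where
      xs⊆ys₁++ys₂ : xs ⊆ ys₁ ++ ys₂
      xs⊆ys₁++ys₂ z∈xs = ∈-++-∷-≢ ys₁ (x∷xs⊆ys (there z∈xs)) (λ z≡x → All.lookup x∉xs z∈xs (≡.sym z≡x))

  foldl-induction : ∀ {b p} {B : Set b} (P : List A → B → Set p) (f : B → A → B) (xs : List A) {s : B} →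
                    P [] s → (∀ pre x rest {t} → pre ++ x ∷ rest ≡ xs → P pre t → P (pre ∷ʳ x) (f t x)) →
                    P xs (foldl f s xs)
  foldl-induction P f xs P[] P-step = go [] xs P[] refl
    where
      go : ∀ pre rest {t} → P pre t → pre ++ rest ≡ xs → P xs (foldl f t rest)
      go pre [] Ppre eq = subst (λ ys → P ys _) (trans (≡.sym (++-identityʳ pre)) eq) Ppre
      go pre (x ∷ rest) Ppre eq = go (pre ∷ʳ x) rest (P-step pre x rest eq Ppre) (trans (∷ʳ-++ pre x rest) eq)

module RankedLists {a} {A : Set a} (_≟_ : DecidableEquality A) (key : A → ℕ) where
  open DecMembership _≟_ using (_∈?_)

  _<ₖ_ : A → A → Set
  x <ₖ y = key x < key y

  Increasing : List A → Set a
  Increasing = AllPairs _<ₖ_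

  <ₖ⇒≢ : ∀ {x y} → x <ₖ y → x ≢ y
  <ₖ⇒≢ x<y refl = <-irrefl refl x<y

  Increasing⇒Unique : ∀ {xs} → Increasing xs → Unique xs
  Increasing⇒Unique = AllPairs.map <ₖ⇒≢

  ∈-∷-below : ∀ {x xs z ys} → All (x <ₖ_) xs → z ∈ xs → z ∈ x ∷ ys → z ∈ ys
  ∈-∷-below x<xs z∈xs (here refl) = ⊥-elim (<-irrefl refl (All.lookup x<xs z∈xs))
  ∈-∷-below x<xs z∈xs (there z∈ys) = z∈ys

  Increasing-≡ : ∀ {xs ys} → Increasing xs → Increasing ys → xs ⊆ ys → ys ⊆ xs → xs ≡ ys
  Increasing-≡ {[]} {[]} _ _ _ _ = refl
  Increasing-≡ {[]} {y ∷ ys} _ _ _ ys⊆ with ys⊆ (here refl)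
  ... | ()
  Increasing-≡ {x ∷ xs} {[]} _ _ xs⊆ _ with xs⊆ (here refl)
  ... | ()
  Increasing-≡ {x ∷ xs} {y ∷ ys} (x<xs ∷ ↑xs) (y<ys ∷ ↑ys) xs⊆ ys⊆ with xs⊆ (here refl) | ys⊆ (here refl)
  ... | here refl | _ = cong (x ∷_) (Increasing-≡ ↑xs ↑ys
          (λ z∈xs → ∈-∷-below x<xs z∈xs (xs⊆ (there z∈xs)))
          (λ z∈ys → ∈-∷-below y<ys z∈ys (ys⊆ (there z∈ys))))
  ... | there x∈ys | here refl = ⊥-elim (<-irrefl refl (All.lookup y<ys x∈ys))
  ... | there x∈ys | there y∈xs = ⊥-elim (<-asym (All.lookup y<ys x∈ys) (All.lookup x<xs y∈xs))

  ∈-take-below : ∀ m {xs u w} → Increasing xs → u ∈ take m xs → w ∈ xs → w <ₖ u → w ∈ take m xs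
  ∈-take-below (suc m) {x ∷ xs} _ (here refl) (here refl) w<u = here refl
  ∈-take-below (suc m) {x ∷ xs} (x<xs ∷ _) (here refl) (there w∈xs) w<u =
    ⊥-elim (<-asym w<u (All.lookup x<xs w∈xs))
  ∈-take-below (suc m) {x ∷ xs} _ (there u∈) (here refl) w<u = here refl
  ∈-take-below (suc m) {x ∷ xs} (_ ∷ ↑xs) (there u∈) (there w∈xs) w<u =
    there (∈-take-below m ↑xs u∈ w∈xs w<u)

  ∉-take⇒full : ∀ m {xs u} → Increasing xs → u ∈ xs → u ∉ take m xs →
                length (take m xs) ≡ m × All (_<ₖ u) (take m xs)
  ∉-take⇒full zero _ _ _ = refl , []
  ∉-take⇒full (suc m) _ (here refl) u∉ = ⊥-elim (u∉ (here refl))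
  ∉-take⇒full (suc m) (x<xs ∷ ↑xs) (there u∈xs) u∉ with ∉-take⇒full m ↑xs u∈xs (λ u∈ → u∉ (there u∈))
  ... | full , below = cong suc full , All.lookup x<xs u∈xs ∷ below

  length-below< : ∀ m {xs u ws} → Increasing xs → u ∈ take m xs → Unique ws →
                  All (λ w → w ∈ xs × w <ₖ u) ws → length ws < m
  length-below< m {xs} {u} {ws} ↑xs u∈ ws! below = ≤-trans
    (Unique∧⊆⇒length≤ (All.map (λ w<u u≡w → <ₖ⇒≢ w<u (≡.sym u≡w)) (All.map proj₂ below) ∷ ws!) u∷ws⊆)
    (subst (_≤ m) (≡.sym (length-take m xs)) (m⊓n≤m m (length xs)))
    where
      u∷ws⊆ : u ∷ ws ⊆ take m xs
      u∷ws⊆ (here refl) = u∈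
      u∷ws⊆ (there w∈ws) = let (w∈xs , w<u) = All.lookup below w∈ws in ∈-take-below m ↑xs u∈ w∈xs w<u

  -- Otherwise take m ys is full and lies below z, so with z it gives m + 1 distinct elements of take m xs.
  ∈-take-transfer : ∀ m {xs ys z} → Increasing xs → Increasing ys → z ∈ take m xs → z ∈ ys →
                    (∀ {w} → w ∈ take m ys → w <ₖ z → w ∈ xs) → z ∈ take m ys
  ∈-take-transfer m {xs} {ys} {z} ↑xs ↑ys z∈xs z∈ys below⊆xs with z ∈? take m ys
  ... | yes z∈ = z∈
  ... | no z∉ with ∉-take⇒full m ↑ys z∈ys z∉
  ... | full , below = ⊥-elim (<-irrefl full (length-below< m ↑xs z∈xs
          (Increasing⇒Unique (AllPairs.take⁺ m ↑ys))
          (All.tabulate λ w∈ → below⊆xs w∈ (All.lookup below w∈) , All.lookup below w∈)))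

  ∈-prefix⇔below : ∀ pre {x rest w} → Increasing (pre ++ x ∷ rest) → w ∈ pre ++ x ∷ rest →
                   (w ∈ pre ⇔ w <ₖ x)
  ∈-prefix⇔below pre {x} {rest} {w} ↑ w∈ = mk⇔ (to pre ↑) (from pre ↑ w∈)
    where
      to : ∀ pre → Increasing (pre ++ x ∷ rest) → w ∈ pre → w <ₖ x
      to (p ∷ pre) (p< ∷ _) (here refl) = All.lookup p< (∈-++⁺ʳ pre (here refl))
      to (p ∷ pre) (_ ∷ ↑) (there w∈pre) = to pre ↑ w∈pre
      from : ∀ pre → Increasing (pre ++ x ∷ rest) → w ∈ pre ++ x ∷ rest → w <ₖ x → w ∈ pre
      from [] _ (here refl) w<x = ⊥-elim (<-irrefl refl w<x)
      from [] (x<rest ∷ _) (there w∈rest) w<x = ⊥-elim (<-asym w<x (All.lookup x<rest w∈rest))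
      from (p ∷ pre) _ (here refl) _ = here refl
      from (p ∷ pre) (_ ∷ ↑) (there w∈) w<x = there (from pre ↑ w∈ w<x)

module _ {n} (G : Graph n) (rank : Fin n → ℕ) (rank-injective : Injective _≡_ _≡_ rank) (k : ℕ) where
  open Algorithm G rank k
  open RankedLists (_≟_ {n}) rank
  open DecMembership (_≟_ {n}) using (_∈?_)

  T-eqᵇ : ∀ {x y} → T (eqᵇ x y) ⇔ x ≡ y
  T-eqᵇ {x} {y} with x ≟ y
  ... | yes x≡y = mk⇔ (λ _ → x≡y) _
  ... | no x≢y = mk⇔ (λ ()) x≢y

  T-memb : ∀ {v xs} → T (memb v xs) ⇔ v ∈ xs
  T-memb = mk⇔ (Any.map (Equivalence.to T-eqᵇ) ∘ any⁻ _ _) (any⁺ _ ∘ Any.map (Equivalence.from T-eqᵇ))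

  upd-≡ : ∀ (f : Sketches) w xs → upd f w xs w ≡ xs
  upd-≡ f w xs rewrite dec-true (w ≟ w) refl = refl

  upd-≢ : ∀ (f : Sketches) {w u} xs → u ≢ w → upd f w xs u ≡ f u
  upd-≢ f {w} {u} xs u≢w rewrite dec-false (u ≟ w) u≢w = refl

  -- Insertion sort and the k smallest elements

  insertR-↭ : ∀ v xs → insertR v xs ↭ v ∷ xs
  insertR-↭ v [] = ↭-refl
  insertR-↭ v (x ∷ xs) with rank v ≤ᵇ rank x
  ... | true = ↭-refl
  ... | false = ↭-trans (prep x (insertR-↭ v xs)) (swap x v ↭-refl)

  sortR-↭ : ∀ xs → sortR xs ↭ xs
  sortR-↭ [] = ↭-refl
  sortR-↭ (x ∷ xs) = ↭-trans (insertR-↭ x (sortR xs)) (prep x (sortR-↭ xs))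

  insertR-increasing : ∀ v {xs} → Increasing xs → v ∉ xs → Increasing (insertR v xs)
  insertR-increasing v {[]} _ _ = [] ∷ []
  insertR-increasing v {x ∷ xs} (x<xs ∷ ↑xs) v∉ with rank v ≤ᵇ rank x | ≤ᵇ-reflects-≤ (rank v) (rank x)
  ... | true | ofʸ v≤x = (v<x ∷ All.map (<-trans v<x) x<xs) ∷ x<xs ∷ ↑xs
    where v<x = ≤∧≢⇒< v≤x (λ eq → v∉ (here (rank-injective eq)))
  ... | false | ofⁿ v≰x = All-resp-↭ (↭-sym (insertR-↭ v xs)) (≰⇒> v≰x ∷ x<xs)
                        ∷ insertR-increasing v ↑xs (v∉ ∘ there)

  sortR-increasing : ∀ {xs} → Unique xs → Increasing (sortR xs)
  sortR-increasing {[]} _ = []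
  sortR-increasing {x ∷ xs} (x∉xs ∷ xs!) =
    insertR-increasing x (sortR-increasing xs!) (λ x∈ → All.lookup x∉xs (∈-resp-↭ (sortR-↭ xs) x∈) refl)

  ranked : List V → List V
  ranked xs = sortR (deduplicate _≟_ xs)

  -- mergePurify X v is definitionally smallest (v ∷ X).
  smallest : List V → List V
  smallest xs = take k (ranked xs)

  ranked-increasing : ∀ xs → Increasing (ranked xs)
  ranked-increasing xs = sortR-increasing (deduplicate-! _≟_ xs)

  ∈-ranked⁻ : ∀ xs → ranked xs ⊆ xs
  ∈-ranked⁻ xs = ∈-deduplicate⁻ _≟_ xs ∘ ∈-resp-↭ (sortR-↭ _)

  ∈-ranked⁺ : ∀ xs → xs ⊆ ranked xs
  ∈-ranked⁺ xs = ∈-resp-↭ (↭-sym (sortR-↭ _)) ∘ ∈-deduplicate⁺ _≟_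

  ∈-smallest⁻ : ∀ xs → smallest xs ⊆ xs
  ∈-smallest⁻ xs = ∈-ranked⁻ xs ∘ ∈-take⁻ k

  smallest-cong : ∀ {xs ys} → xs ⊆ ys → ys ⊆ xs → smallest xs ≡ smallest ys
  smallest-cong {xs} {ys} xs⊆ys ys⊆xs = cong (take k) (Increasing-≡
    (ranked-increasing xs) (ranked-increasing ys)
    (∈-ranked⁺ ys ∘ xs⊆ys ∘ ∈-ranked⁻ xs) (∈-ranked⁺ xs ∘ ys⊆xs ∘ ∈-ranked⁻ ys))

  smallest-↭ : ∀ {xs ys} → xs ↭ ys → smallest xs ≡ smallest ys
  smallest-↭ xs↭ys = smallest-cong (∈-resp-↭ xs↭ys) (∈-resp-↭ (↭-sym xs↭ys))

  ∈-smallest-⊆ : ∀ {xs ys z} → xs ⊆ ys → z ∈ xs → z ∈ smallest ys → z ∈ smallest xs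
  ∈-smallest-⊆ {xs} {ys} xs⊆ys z∈xs z∈ = ∈-take-transfer k (ranked-increasing ys) (ranked-increasing xs)
    z∈ (∈-ranked⁺ xs z∈xs) (λ w∈ _ → ∈-ranked⁺ ys (xs⊆ys (∈-smallest⁻ xs w∈)))

  smallest-sandwich : ∀ {xs ys} → smallest ys ⊆ xs → xs ⊆ ys → smallest xs ≡ smallest ys
  smallest-sandwich {xs} {ys} small⊆xs xs⊆ys = Increasing-≡
    (AllPairs.take⁺ k (ranked-increasing xs)) (AllPairs.take⁺ k (ranked-increasing ys))
    (λ z∈ → ∈-take-transfer k (ranked-increasing xs) (ranked-increasing ys) z∈
              (∈-ranked⁺ ys (xs⊆ys (∈-smallest⁻ xs z∈))) (λ w∈ _ → ∈-ranked⁺ xs (small⊆xs w∈)))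
    (λ z∈ → ∈-smallest-⊆ xs⊆ys (small⊆xs z∈) z∈)

  mergePurify-smallest : ∀ xs v → mergePurify (smallest xs) v ≡ smallest (v ∷ xs)
  mergePurify-smallest xs v = smallest-sandwich small⊆ ⊆v∷xs
    where
      small⊆ : smallest (v ∷ xs) ⊆ v ∷ smallest xs
      small⊆ {z} z∈ with ∈-smallest⁻ (v ∷ xs) z∈
      ... | here refl = here refl
      ... | there z∈xs = there (∈-smallest-⊆ there z∈xs z∈)
      ⊆v∷xs : v ∷ smallest xs ⊆ v ∷ xs
      ⊆v∷xs (here refl) = here refl
      ⊆v∷xs (there z∈) = there (∈-smallest⁻ xs z∈)

  ∈-smallest⇔InTilde : ∀ (S : V → Set) xs → (∀ {z} → S z ⇔ z ∈ xs) → ∀ u → u ∈ smallest xs ⇔ InTilde rank k S u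
  ∈-smallest⇔InTilde S xs S⇔∈ u = mk⇔ to from
    where
      ↑ = ranked-increasing xs
      to : u ∈ smallest xs → InTilde rank k S u
      to u∈ = Equivalence.from S⇔∈ (∈-smallest⁻ xs u∈) , λ (ws , |ws|≡k , ws! , below) →
        <-irrefl |ws|≡k (length-below< k ↑ u∈ ws!
          (All.map (λ (Sw , w<u) → ∈-ranked⁺ xs (Equivalence.to S⇔∈ Sw) , w<u) below))
      from : InTilde rank k S u → u ∈ smallest xs
      from (Su , no-witness) with u ∈? smallest xs
      ... | yes u∈ = u∈
      ... | no u∉ with ∉-take⇒full k ↑ (∈-ranked⁺ xs (Equivalence.to S⇔∈ Su)) u∉
      ... | full , below = ⊥-elim (no-witness (smallest xs , full , Increasing⇒Unique (AllPairs.take⁺ k ↑) ,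
              All.tabulate (λ w∈ → Equivalence.from S⇔∈ (∈-smallest⁻ xs w∈) , All.lookup below w∈)))

  -- Processing one vertex

  sketches : IterState → Sketches
  sketches = proj₁

  additions : IterState → Sketches
  additions = proj₁ ∘ proj₂

  Enters : V → List V → Set
  Enters v xs = v ∉ xs × v ∈ mergePurify xs v

  T-enters : ∀ {v xs} → T (not (memb v xs) ∧ memb v (mergePurify xs v)) ⇔ Enters v xs
  T-enters {v} {xs} with memb v xs | T-memb {v} {xs}
  ... | true  | v∈⇔ = mk⇔ (λ ()) (λ (v∉ , _) → v∉ (Equivalence.to v∈⇔ _))
  ... | false | v∈⇔ = mk⇔ (λ t → Equivalence.from v∈⇔ , Equivalence.to T-memb t)
                          (Equivalence.from T-memb ∘ proj₂)

  processW-∉ : ∀ x ws (st : IterState) {w} → w ∉ ws → sketches (foldl (processW x) st ws) w ≡ sketches st w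
  processW-∉ x [] st w∉ = refl
  processW-∉ x (w₀ ∷ ws) st@(X , _) w∉ = trans (processW-∉ x ws (processW x st w₀) (w∉ ∘ there))
                                              (upd-≢ X _ (w∉ ∘ here))

  processW-∈ : ∀ x ws (st : IterState) {w} → Unique ws → w ∈ ws →
               sketches (foldl (processW x) st ws) w ≡ mergePurify (sketches st w) x
  processW-∈ x (w₀ ∷ ws) st@(X , _) (w₀∉ws ∷ _) (here refl) =
    trans (processW-∉ x ws (processW x st w₀) (λ w₀∈ → All.lookup w₀∉ws w₀∈ refl)) (upd-≡ X w₀ _)
  processW-∈ x (w₀ ∷ ws) st@(X , _) (w₀∉ws ∷ ws!) (there w∈) =
    trans (processW-∈ x ws (processW x st w₀) ws! w∈)
          (cong (λ xs → mergePurify xs x) (upd-≢ X _ (λ w≡w₀ → All.lookup w₀∉ws w∈ (≡.sym w≡w₀))))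

  ∈-processW-additions : ∀ x (st : IterState) w {v u} →
    u ∈ additions (processW x st w) v ⇔ (u ∈ additions st v ⊎ (v ≡ x × u ≡ w × Enters x (sketches st w)))
  ∈-processW-additions x (X , A , _) w {v} {u}
    with not (memb x (X w)) ∧ memb x (mergePurify (X w) x) | T-enters {x} {X w}
  ... | false | enters⇔ = mk⇔ inj₁ λ { (inj₁ u∈) → u∈ ; (inj₂ (_ , _ , e)) → ⊥-elim (Equivalence.from enters⇔ e) }
  ... | true | enters⇔ with v ≟ x
  ...   | no v≢x = mk⇔ inj₁ λ { (inj₁ u∈) → u∈ ; (inj₂ (v≡x , _)) → ⊥-elim (v≢x v≡x) }
  ...   | yes refl = mk⇔ to from
    where
      to : u ∈ w ∷ A x → _
      to (here refl) = inj₂ (refl , refl , Equivalence.to enters⇔ _)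
      to (there u∈) = inj₁ u∈
      from : _ → u ∈ w ∷ A x
      from (inj₁ u∈) = there u∈
      from (inj₂ (_ , refl , _)) = here refl

  processW-additions : ∀ x ws (st : IterState) {v u} → Unique ws →
    u ∈ additions (foldl (processW x) st ws) v ⇔ (u ∈ additions st v ⊎ (v ≡ x × u ∈ ws × Enters x (sketches st u)))
  processW-additions x [] st _ = mk⇔ inj₁ λ { (inj₁ u∈) → u∈ ; (inj₂ (_ , () , _)) }
  processW-additions x (w ∷ ws) st@(X , _) {v} {u} (w∉ws ∷ ws!) = mk⇔ to from
    where
      st₁ = processW x st w
      later = processW-additions x ws st₁ {v} {u} ws!
      now = ∈-processW-additions x st w {v} {u}
      unchanged : u ∈ ws → sketches st₁ u ≡ X u
      unchanged u∈ws = upd-≢ X _ (λ u≡w → All.lookup w∉ws u∈ws (≡.sym u≡w))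
      to : u ∈ additions (foldl (processW x) st₁ ws) v → u ∈ additions st v ⊎ (v ≡ x × u ∈ w ∷ ws × Enters x (X u))
      to u∈ with Equivalence.to later u∈
      ... | inj₂ (v≡x , u∈ws , e) = inj₂ (v≡x , there u∈ws , subst (Enters x) (unchanged u∈ws) e)
      ... | inj₁ u∈₁ with Equivalence.to now u∈₁
      ...   | inj₁ u∈₀ = inj₁ u∈₀
      ...   | inj₂ (v≡x , refl , e) = inj₂ (v≡x , here refl , e)
      from : u ∈ additions st v ⊎ (v ≡ x × u ∈ w ∷ ws × Enters x (X u)) → u ∈ additions (foldl (processW x) st₁ ws) v
      from (inj₁ u∈₀) = Equivalence.from later (inj₁ (Equivalence.from now (inj₁ u∈₀)))
      from (inj₂ (v≡x , here refl , e)) = Equivalence.from later (inj₁ (Equivalence.from now (inj₂ (v≡x , refl , e))))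
      from (inj₂ (v≡x , there u∈ws , e)) =
        Equivalence.from later (inj₂ (v≡x , u∈ws , subst (Enters x) (≡.sym (unchanged u∈ws)) e))

  -- One iteration

  order : List V
  order = sortR (allFin n)

  order-increasing : Increasing order
  order-increasing = sortR-increasing (allFin⁺ n)

  ∈-order : ∀ v → v ∈ order
  ∈-order v = ∈-resp-↭ (↭-sym (sortR-↭ _)) (∈-allFin v)

  below : V → List V
  below v = filter (λ y → rank y <? rank v) (allFin n)

  ∈-below⇔ : ∀ {v y} → y ∈ below v ⇔ y <ₖ v
  ∈-below⇔ {v} = mk⇔ (proj₂ ∘ ∈-filter⁻ (λ y → rank y <? rank v) {xs = allFin n})
                     (∈-filter⁺ (λ y → rank y <? rank v) (∈-allFin _))

  ∈-prefix⇔∈-below : ∀ pre {x rest y} → pre ++ x ∷ rest ≡ order → y ∈ pre ⇔ y ∈ below x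
  ∈-prefix⇔∈-below pre {y = y} eq = ⇔-trans
    (∈-prefix⇔below pre (subst Increasing (≡.sym eq) order-increasing) (subst (y ∈_) (≡.sym eq) (∈-order y)))
    (⇔-sym ∈-below⇔)

  nbhd-unique : ∀ A → Unique (nbhd A)
  nbhd-unique A = filter⁺ _ (allFin⁺ n)

  module Iteration (Ap : Sketches) (B : V → List V) where
    open ≡-Reasoning

    sends? : ∀ w y → Dec (w ∈ nbhd (Ap y))
    sends? w y = w ∈? nbhd (Ap y)

    -- The vertices among ys that an iteration merges into X_w.
    senders : List V → V → List V
    senders ys w = filter (sends? w) ys

    senders-mono : ∀ {ys zs} w → ys ⊆ zs → senders ys w ⊆ senders zs w
    senders-mono w = filter⁺′ _ _ (λ w∈ → w∈)

    senders-∷ʳ-accept : ∀ ys {x w} → w ∈ nbhd (Ap x) → senders (ys ∷ʳ x) w ≡ senders ys w ∷ʳ x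
    senders-∷ʳ-accept ys {x} {w} w∈ =
      trans (filter-++ (sends? w) ys [ x ]) (cong (senders ys w ++_) (filter-accept (sends? w) w∈))

    senders-∷ʳ-reject : ∀ ys {x w} → w ∉ nbhd (Ap x) → senders (ys ∷ʳ x) w ≡ senders ys w
    senders-∷ʳ-reject ys {x} {w} w∉ =
      trans (filter-++ (sends? w) ys [ x ])
            (trans (cong (senders ys w ++_) (filter-reject (sends? w) w∉)) (++-identityʳ _))

    -- When v is merged into X_u, X_u holds the merges of exactly the vertices of smaller rank.
    Added : V → V → Set
    Added v u = u ∈ nbhd (Ap v) × Enters v (smallest (B u ++ senders (below v) u))

    Invariant : List V → IterState → Set
    Invariant pre st = (∀ w → sketches st w ≡ smallest (B w ++ senders pre w)) ×
                       (∀ {v u} → u ∈ additions st v ⇔ (v ∈ pre × Added v u))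

    invariant-start : ∀ X → (∀ w → X w ≡ smallest (B w)) → Invariant [] (X , (λ _ → []) , false)
    invariant-start X X≡ = (λ w → trans (X≡ w) (cong smallest (≡.sym (++-identityʳ (B w)))))
                         , mk⇔ (λ ()) λ { (() , _) }

    invariant-step : ∀ pre x rest {st} → pre ++ x ∷ rest ≡ order → Invariant pre st →
                     Invariant (pre ∷ʳ x) (processV Ap st x)
    invariant-step pre x rest {st@(X , A , _)} eq (X≡ , A⇔) = X′≡ , A′⇔
      where
        st′ = processV Ap st x
        pre⇔below : ∀ {y} → y ∈ pre ⇔ y ∈ below x
        pre⇔below = ∈-prefix⇔∈-below pre eq

        X-before : ∀ u → X u ≡ smallest (B u ++ senders (below x) u)
        X-before u = trans (X≡ u) (smallest-cong
          (++⁺ʳ (B u) (senders-mono u (Equivalence.to pre⇔below)))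
          (++⁺ʳ (B u) (senders-mono u (Equivalence.from pre⇔below))))

        X′≡ : ∀ w → sketches st′ w ≡ smallest (B w ++ senders (pre ∷ʳ x) w)
        X′≡ w with w ∈? nbhd (Ap x)
        ... | yes w∈ = begin
          sketches st′ w
            ≡⟨ processW-∈ x (nbhd (Ap x)) st (nbhd-unique (Ap x)) w∈ ⟩
          mergePurify (X w) x
            ≡⟨ cong (λ xs → mergePurify xs x) (X≡ w) ⟩
          mergePurify (smallest (B w ++ senders pre w)) x
            ≡⟨ mergePurify-smallest (B w ++ senders pre w) x ⟩
          smallest (x ∷ B w ++ senders pre w)
            ≡⟨ smallest-↭ (∷↭∷ʳ x (B w ++ senders pre w)) ⟩
          smallest ((B w ++ senders pre w) ∷ʳ x)
            ≡⟨ cong smallest (++-assoc (B w) (senders pre w) [ x ]) ⟩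
          smallest (B w ++ senders pre w ∷ʳ x)
            ≡⟨ cong (λ ys → smallest (B w ++ ys)) (senders-∷ʳ-accept pre w∈) ⟨
          smallest (B w ++ senders (pre ∷ʳ x) w)
            ∎
        ... | no w∉ = begin
          sketches st′ w
            ≡⟨ processW-∉ x (nbhd (Ap x)) st w∉ ⟩
          X w
            ≡⟨ X≡ w ⟩
          smallest (B w ++ senders pre w)
            ≡⟨ cong (λ ys → smallest (B w ++ ys)) (senders-∷ʳ-reject pre w∉) ⟨
          smallest (B w ++ senders (pre ∷ʳ x) w)
            ∎

        A′⇔ : ∀ {v u} → u ∈ additions st′ v ⇔ (v ∈ pre ∷ʳ x × Added v u)
        A′⇔ {v} {u} = ⇔-trans (processW-additions x (nbhd (Ap x)) st (nbhd-unique (Ap x))) (mk⇔ to from)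
          where
            to : u ∈ A v ⊎ (v ≡ x × u ∈ nbhd (Ap x) × Enters x (X u)) → v ∈ pre ∷ʳ x × Added v u
            to (inj₁ u∈) = let (v∈pre , added) = Equivalence.to A⇔ u∈ in ∈-++⁺ˡ v∈pre , added
            to (inj₂ (refl , u∈ , e)) = ∈-++⁺ʳ pre (here refl) , u∈ , subst (Enters x) (X-before u) e
            from : v ∈ pre ∷ʳ x × Added v u → u ∈ A v ⊎ (v ≡ x × u ∈ nbhd (Ap x) × Enters x (X u))
            from (v∈ , added@(u∈ , e)) with ∈-++⁻ pre v∈
            ... | inj₁ v∈pre = inj₁ (Equivalence.from A⇔ (v∈pre , added))
            ... | inj₂ (here refl) = inj₂ (refl , u∈ , subst (Enters x) (≡.sym (X-before u)) e)

    iteration-invariant : ∀ X → (∀ w → X w ≡ smallest (B w)) → Invariant order (iteration X Ap)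
    iteration-invariant X X≡ = foldl-induction Invariant (processV Ap) order (invariant-start X X≡) invariant-step

  -- Balls and the round invariant

  Dist≤? : ∀ d v u → Dec (Dist≤ G d v u)
  Dist≤? zero v u with v ≟ u
  ... | yes refl = yes here
  ... | no v≢u = no λ { here → v≢u refl }
  Dist≤? (suc d) v u with v ≟ u
  ... | yes refl = yes here
  ... | no v≢u with any? (λ w → (adj G v w Bool.≟ true) ×-dec Dist≤? d w u)
  ...   | yes (w , v~w , w→u) = yes (step v~w w→u)
  ...   | no ¬walk = no λ { here → v≢u refl ; (step v~w w→u) → ¬walk (_ , v~w , w→u) }

  Dist≤-suc : ∀ {d v u} → Dist≤ G d v u → Dist≤ G (suc d) v u
  Dist≤-suc here = here
  Dist≤-suc (step v~w w→u) = step v~w (Dist≤-suc w→u)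

  Dist≥ : ℕ → V → V → Set
  Dist≥ zero _ _ = ⊤
  Dist≥ (suc d) u v = ¬ Dist≤ G d u v

  Dist≥-step : ∀ d {w y z} → ¬ Dist≤ G d w z → adj G w y ≡ true → Dist≥ d y z
  Dist≥-step zero _ _ = tt
  Dist≥-step (suc d) ¬w→z w~y y→z = ¬w→z (step w~y y→z)

  ball : ℕ → V → List V
  ball d w = filter (Dist≤? d w) (allFin n)

  ∈-ball⇔ : ∀ {d w u} → u ∈ ball d w ⇔ Dist≤ G d w u
  ∈-ball⇔ {d} {w} = mk⇔ (proj₂ ∘ ∈-filter⁻ (Dist≤? d w) {xs = allFin n}) (∈-filter⁺ (Dist≤? d w) (∈-allFin _))

  ∈-nbhd⁺ : ∀ {A y w} → y ∈ A → adj G y w ≡ true → w ∈ nbhd A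
  ∈-nbhd⁺ {w = w} y∈A y~w = ∈-filter⁺ (T? ∘ _) (∈-allFin w)
    (any⁺ _ (Any.map (λ { refl → Equivalence.from T-∨ (inj₂ (Equivalence.from T-≡ y~w)) }) y∈A))

  ∈-nbhd-Dist≤ : ∀ {A d z w} → (∀ {y} → y ∈ A → Dist≤ G d y z) → w ∈ nbhd A → Dist≤ G (suc d) w z
  ∈-nbhd-Dist≤ {A} {w = w} A→z w∈ with find (any⁻ _ A (proj₂ (∈-filter⁻ (T? ∘ _) {xs = allFin n} w∈)))
  ... | y , y∈A , y≡w∨y~w with Equivalence.to T-∨ y≡w∨y~w
  ...   | inj₁ y≡w = subst (λ x → Dist≤ G _ x _) (Equivalence.to (T-eqᵇ {y} {w}) y≡w) (Dist≤-suc (A→z y∈A))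
  ...   | inj₂ y~w = step (trans (sym G w y) (Equivalence.to T-≡ y~w)) (A→z y∈A)

  additionsAfter : ℕ → Sketches
  additionsAfter i = proj₂ (run i)

  record RoundInvariant (i : ℕ) : Set where
    field
      sketch≡smallest-ball : ∀ w → sketchesAfter i w ≡ smallest (ball i w)
      addition-within : ∀ {v u} → u ∈ additionsAfter i v → Dist≤ G i u v
      fresh⇒addition : ∀ {v u} → v ∈ sketchesAfter i u → Dist≥ i u v → u ∈ additionsAfter i v

  round-zero : 1 ≤ k → RoundInvariant 0
  round-zero 1≤k = record
    { sketch≡smallest-ball = λ w → ≡.sym (trans (smallest-cong ball⊆ ⊆ball) (take-all k [ w ] 1≤k))
    ; addition-within = λ { (here refl) → here }
    ; fresh⇒addition = λ { (here refl) _ → here refl }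
    }
    where
      ball⊆ : ∀ {w} → ball 0 w ⊆ [ w ]
      ball⊆ z∈ with Equivalence.to ∈-ball⇔ z∈
      ... | here = here refl
      ⊆ball : ∀ {w} → [ w ] ⊆ ball 0 w
      ⊆ball (here refl) = Equivalence.from ∈-ball⇔ here

  round-suc : ∀ {i} → RoundInvariant i → RoundInvariant (suc i)
  round-suc {i} inv = record
    { sketch≡smallest-ball = λ w → trans (proj₁ after w) (smallest-sandwich (smallest-ball⊆ w) (⊆ball w))
    ; addition-within = λ u∈ → ∈-nbhd-Dist≤ addition-within (proj₁ (proj₂ (Equivalence.to (proj₂ after) u∈)))
    ; fresh⇒addition = fresh
    }
    where
      open RoundInvariant inv
      open Iteration (additionsAfter i) (ball i)
      after = iteration-invariant (sketchesAfter i) sketch≡smallest-ball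

      ⊆ball : ∀ w → ball i w ++ senders order w ⊆ ball (suc i) w
      ⊆ball w z∈ with ∈-++⁻ (ball i w) z∈
      ... | inj₁ z∈ball = Equivalence.from ∈-ball⇔ (Dist≤-suc (Equivalence.to ∈-ball⇔ z∈ball))
      ... | inj₂ z-sends = Equivalence.from ∈-ball⇔
              (∈-nbhd-Dist≤ addition-within (proj₂ (∈-filter⁻ (sends? w) {xs = order} z-sends)))

      smallest-ball⊆ : ∀ w → smallest (ball (suc i) w) ⊆ ball i w ++ senders order w
      smallest-ball⊆ w {z} z∈ with Dist≤? i w z | Equivalence.to ∈-ball⇔ (∈-smallest⁻ (ball (suc i) w) z∈)
      ... | yes w→z | _ = ∈-++⁺ˡ (Equivalence.from ∈-ball⇔ w→z)
      ... | no ¬w→z | here = ⊥-elim (¬w→z here)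
      ... | no ¬w→z | step {w = y} w~y y→z = ∈-++⁺ʳ (ball i w) (∈-filter⁺ (sends? w) (∈-order z)
              (∈-nbhd⁺ y-added (trans (sym G y w) w~y)))
        where
          z∈Xy : z ∈ sketchesAfter i y
          z∈Xy = subst (z ∈_) (≡.sym (sketch≡smallest-ball y)) (∈-smallest-⊆
            (λ z′∈ → Equivalence.from ∈-ball⇔ (step w~y (Equivalence.to ∈-ball⇔ z′∈)))
            (Equivalence.from ∈-ball⇔ y→z) z∈)
          y-added : y ∈ additionsAfter i z
          y-added = fresh⇒addition z∈Xy (Dist≥-step i ¬w→z w~y)

      fresh : ∀ {v u} → v ∈ sketchesAfter (suc i) u → ¬ Dist≤ G i u v → u ∈ additionsAfter (suc i) v
      fresh {v} {u} v∈ ¬u→v = Equivalence.from (proj₂ after) (∈-order v , u∈nbhd , v∉earlier , v∈merged)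
        where
          v∉ball : v ∉ ball i u
          v∉ball = ¬u→v ∘ Equivalence.to ∈-ball⇔
          v∈smallest : v ∈ smallest (ball i u ++ senders order u)
          v∈smallest = subst (v ∈_) (proj₁ after u) v∈
          v-sends : v ∈ senders order u
          v-sends with ∈-++⁻ (ball i u) (∈-smallest⁻ _ v∈smallest)
          ... | inj₁ v∈ball = ⊥-elim (v∉ball v∈ball)
          ... | inj₂ v-sends = v-sends
          u∈nbhd : u ∈ nbhd (additionsAfter i v)
          u∈nbhd = proj₂ (∈-filter⁻ (sends? u) {xs = order} v-sends)
          earlier : List V
          earlier = smallest (ball i u ++ senders (below v) u)
          v∉earlier : v ∉ earlier
          v∉earlier v∈earlier with ∈-++⁻ (ball i u) (∈-smallest⁻ _ v∈earlier)
          ... | inj₁ v∈ball = v∉ball v∈ball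
          ... | inj₂ v-sends′ = <-irrefl refl
                  (Equivalence.to ∈-below⇔ (proj₁ (∈-filter⁻ (sends? u) {xs = below v} v-sends′)))
          v∷⊆ : v ∷ ball i u ++ senders (below v) u ⊆ ball i u ++ senders order u
          v∷⊆ (here refl) = ∈-++⁺ʳ (ball i u) v-sends
          v∷⊆ (there z∈) = ++⁺ʳ (ball i u) (senders-mono {below v} u (λ {y} _ → ∈-order y)) z∈
          v∈merged : v ∈ mergePurify earlier v
          v∈merged = subst (v ∈_) (≡.sym (mergePurify-smallest (ball i u ++ senders (below v) u) v))
                           (∈-smallest-⊆ v∷⊆ (here refl) v∈smallest)

  round-invariant : 1 ≤ k → ∀ i → RoundInvariant i
  round-invariant 1≤k zero = round-zero 1≤k
  round-invariant 1≤k (suc i) = round-suc (round-invariant 1≤k i)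

  ∈-sketchesAfter⇔InTilde : 1 ≤ k → ∀ i v u → u ∈ sketchesAfter i v ⇔ InTilde rank k (Ball G i v) u
  ∈-sketchesAfter⇔InTilde 1≤k i v u = ⇔-trans
    (mk⇔ (subst (u ∈_) X≡) (subst (u ∈_) (≡.sym X≡)))
    (∈-smallest⇔InTilde (Ball G i v) (ball i v) (⇔-sym ∈-ball⇔) u)
    where X≡ = RoundInvariant.sketch≡smallest-ball (round-invariant 1≤k i) v

lemma7 : ∀ {n} (G : Graph n) (rank : Fin n → ℕ) → Injective _≡_ _≡_ rank →
         (k : ℕ) → 1 ≤ k → (ℓ i : ℕ) → Algorithm.Executed G rank k ℓ i →
         ∀ v u → (u ∈ Algorithm.sketchesAfter G rank k i v) ⇔ InTilde rank k (Ball G i v) u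
lemma7 G rank rank-injective k 1≤k ℓ i _ = ∈-sketchesAfter⇔InTilde G rank rank-injective k 1≤k i
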